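{- Let $h=(1,h_1,h_2,-w)\in\mathbb{Z}^4$ with $w>0$ and $3w\le h_2\le\binom{h_1+1}{2}$. Let $x$ be the smallest integer $k$ with $3w\le\binom{k+1}{2}$ and let $y=\min\{h_2,\binom{x+1}{2}\}$. If there exists a $2$-dimensional connected Buchsbaum complex $\Delta$ with $h(\Delta)=(1,x,y,-w)$, then there exists a $2$-dimensional connected Buchsbaum complex $\Gamma$ with $h(\Gamma)=h$.
   Context: A simplicial complex on $[n]$ is a family of subsets of $[n]$ containing all singletons and closed under subsets. For a $2$-dimensional complex with $f$-vector $(1,f_0,f_1,f_2)$, the $h$-vector is $(1,\,f_0-3,\,f_1-2f_0+3,\,f_2-f_1+f_0-1)$. A $2$-dimensional complex is Buchsbaum if it is pure (all facets have $3$ elements) and every vertex link $\mathrm{lk}_\Delta(v)=\{G: v\notin G, G\cup\{v\}\in\Delta\}$ is a connected graph. -}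

module Defs where

open import Data.Bool using (Bool; true; false; T; _∧_)
open import Data.Nat using (ℕ; zero; suc; _≤_; _<_; _⊓_; _∸_; _*_; _≡ᵇ_)
open import Data.Nat.Combinatorics using (_C_)
open import Data.Integer as ℤ using (ℤ; +_; -_)
open import Data.Fin using (Fin)
open import Data.Fin.Subset using (Subset; ⁅_⁆; _∈_; _∉_; _⊆_; _∪_; ∣_∣)
open import Data.Vec using (Vec; []; _∷_)
open import Data.List using (List; [_]; map; _++_; filter; length)
open import Data.Product using (Σ; ∃; _×_; _,_)
open import Relation.Nullary using (¬_)
open import Relation.Unary using (Pred)
open import Relation.Binary.PropositionalEquality using (_≡_)
open import Data.Bool.Properties using (T?)

record Complex (n : ℕ) : Set where
  field
    face       : Subset n → Bool
    singletons : ∀ (i : Fin n) → face ⁅ i ⁆ ≡ true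
    downClosed : ∀ (σ τ : Subset n) → σ ⊆ τ → face τ ≡ true → face σ ≡ true
open Complex public

_∈Δ_ : ∀ {n} → Subset n → Complex n → Set
σ ∈Δ Δ = face Δ σ ≡ true

subsets : ∀ n → List (Subset n)
subsets zero    = [ [] ]
subsets (suc n) = map (false ∷_) (subsets n) ++ map (true ∷_) (subsets n)

faceCount : ∀ {n} → Complex n → ℕ → ℕ
faceCount Δ k = length (filter (λ σ → T? (face Δ σ ∧ (∣ σ ∣ ≡ᵇ k))) (subsets _))

f₀ f₁ f₂ : ∀ {n} → Complex n → ℤ
f₀ Δ = + faceCount Δ 1
f₁ Δ = + faceCount Δ 2
f₂ Δ = + faceCount Δ 3

h₁ h₂ h₃ : ∀ {n} → Complex n → ℤ
h₁ Δ = f₀ Δ ℤ.- + 3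
h₂ Δ = f₁ Δ ℤ.- (+ 2) ℤ.* f₀ Δ ℤ.+ + 3
h₃ Δ = f₂ Δ ℤ.- f₁ Δ ℤ.+ f₀ Δ ℤ.- + 1

TwoDim : ∀ {n} → Complex n → Set
TwoDim {n} Δ = (∃ λ (τ : Subset n) → τ ∈Δ Δ × ∣ τ ∣ ≡ 3)
             × (∀ (σ : Subset n) → σ ∈Δ Δ → ∣ σ ∣ ≤ 3)

Pure2 : ∀ {n} → Complex n → Set
Pure2 {n} Δ = ∀ (σ : Subset n) → σ ∈Δ Δ → ∃ λ (τ : Subset n) → τ ∈Δ Δ × σ ⊆ τ × ∣ τ ∣ ≡ 3

data Reach {n : ℕ} (F : Pred (Subset n) _) : Fin n → Fin n → Set where
  here : ∀ {u} → Reach F u u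
  step : ∀ {u v w} → F (⁅ u ⁆ ∪ ⁅ v ⁆) → Reach F v w → Reach F u w

Connected : ∀ {n} → Pred (Subset n) _ → Set
Connected {n} F = ∀ (u w : Fin n) → F ⁅ u ⁆ → F ⁅ w ⁆ → Reach F u w

faces : ∀ {n} → Complex n → Pred (Subset n) _
faces Δ σ = σ ∈Δ Δ

lk : ∀ {n} → Complex n → Fin n → Pred (Subset n) _
lk Δ v G = (v ∉ G) × ((G ∪ ⁅ v ⁆) ∈Δ Δ)

-- (2-dimensional) Buchsbaum: pure and every vertex link is a connected graph
-- (the link of a 2-dimensional complex has no faces of more than 2 elements, so it is a graph)
Buchsbaum : ∀ {n} → Complex n → Set
Buchsbaum {n} Δ = Pure2 Δ × (∀ (v : Fin n) → Connected (lk Δ v))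

HasConnBuchsbaum : ℤ → ℤ → ℤ → Set
HasConnBuchsbaum a b c =
  ∃ λ (n : ℕ) → ∃ λ (Δ : Complex n) →
    TwoDim Δ × Connected (faces Δ) × Buchsbaum Δ
    × h₁ Δ ≡ a × h₂ Δ ≡ b × h₃ Δ ≡ c

IsLeastX : ℕ → ℕ → Set
IsLeastX w x = (3 * w ≤ suc x C 2) × (∀ k → k < x → ¬ (3 * w ≤ suc k C 2))

module Submission where

-- Two local moves preserve "2-dimensional, connected and Buchsbaum" and shift the
-- h-vector in one coordinate:
--   * an ear (module Ear) cones a new vertex 0 over an edge {a,c}; it adds the faces
--     {0}, {0,a}, {0,c}, {0,a,c}, so f changes by (1,2,1) and h by (1,0,0);
--   * a fill (module Fill) adds {p,r} and {p,q,r} along an induced path p–q–r; f changes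
--     by (0,1,1) and h by (0,1,0).  Vertex links stay connected because each new link
--     edge hangs off an old link vertex.
-- A fill is possible whenever h₂ < C(h₁+1, 2): then f₁ < C(f₀, 2), so an edge {p,r} is
-- missing, and a walk from p to r in the connected complex leaves the neighbourhood of p
-- along an induced path.  By minimality of x and 3w ≤ h₂ ≤ C(h₁+1, 2) we get x ≤ h₁, so
-- h₁ - x ears followed by h₂ - y fills reach (1, h₁, h₂, -w).

open import Defs
open import Data.Bool using (Bool; true; false; _∧_; _∨_)
open import Data.Bool.Properties using (T?; ⇔→≡; ∨-assoc; ∨-identityʳ; ∧-zeroʳ; ∧-distribʳ-∨)
import Data.Bool as Bool
open import Data.Nat using (ℕ; zero; suc; _+_; _*_; _≤_; _<_; z≤n; s≤s; _≡ᵇ_; _∸_; _⊓_)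
import Data.Nat.Properties as ℕP
open import Data.Nat.Properties using (+-identityʳ; +-suc; +-assoc; +-comm)
open import Data.Nat.Combinatorics using (_C_; nC1≡n; nCk+nC[k+1]≡[n+1]C[k+1])
open import Data.Nat.Tactic.RingSolver using () renaming (solve-∀ to ℕ-solve-∀)
open import Data.Integer as ℤ using (ℤ; +_; -_)
import Data.Integer.Properties as ℤP
open import Data.Integer.Tactic.RingSolver using (solve-∀)
open import Data.Fin using (Fin; zero; suc; _≟_)
import Data.Fin.Properties as FinP
open import Data.Fin.Subset
open import Data.Fin.Subset.Properties
open import Data.Vec using ([]; _∷_; here; there)
open import Data.Vec.Properties using (≡-dec)
open import Data.List using (List; []; _∷_; map; _++_; filter; length)
open import Data.List.Relation.Unary.Any using (Any; here; there; any?)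
open import Data.List.Relation.Unary.All as All using (All)
open import Data.List.Relation.Unary.Unique.Propositional using (Unique)
open import Data.List.Relation.Unary.AllPairs using ([]; _∷_)
open import Data.Product using (∃; ∃₂; _×_; _,_; proj₁; proj₂)
open import Data.Sum using (_⊎_; inj₁; inj₂)
open import Function using (_∘_; id)
open import Function.Bundles using (mk⇔)
open import Relation.Nullary using (¬_; Dec; yes; no; does; contradiction)
open import Relation.Nullary.Decidable using (dec-true; dec-false)
open import Relation.Unary using (Pred)
open import Relation.Binary.Definitions using (DecidableEquality)
open import Relation.Binary.PropositionalEquality

does⁻ : ∀ {P : Set} (d : Dec P) → does d ≡ true → P
does⁻ (yes p) _ = p
does⁻ (no _)  ()

bool-ext : ∀ {b c : Bool} → (b ≡ true → c ≡ true) → (c ≡ true → b ≡ true) → b ≡ c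
bool-ext f g = ⇔→≡ (mk⇔ f g)

true≢false : ∀ {b : Bool} → b ≡ true → b ≡ false → ∀ {A : Set} → A
true≢false refl ()

∨-introˡ : ∀ {b c : Bool} → b ≡ true → b ∨ c ≡ true
∨-introˡ refl = refl

∨-introʳ : ∀ (b : Bool) {c : Bool} → c ≡ true → b ∨ c ≡ true
∨-introʳ true  _ = refl
∨-introʳ false e = e

∨-elim : ∀ (b : Bool) {c : Bool} → b ∨ c ≡ true → b ≡ true ⊎ c ≡ true
∨-elim true  _ = inj₁ refl
∨-elim false e = inj₂ e

ind : Bool → ℕ
ind true  = 1
ind false = 0

count : ∀ {A : Set} → (A → Bool) → List A → ℕ
count b []       = 0
count b (x ∷ xs) = ind (b x) + count b xs

length-filter : ∀ {A : Set} (b : A → Bool) xs → length (filter (λ x → T? (b x)) xs) ≡ count b xs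
length-filter b [] = refl
length-filter b (x ∷ xs) with b x
... | true  = cong suc (length-filter b xs)
... | false = length-filter b xs

count-++ : ∀ {A : Set} (b : A → Bool) xs ys → count b (xs ++ ys) ≡ count b xs + count b ys
count-++ b []       ys = refl
count-++ b (x ∷ xs) ys = trans (cong (_+_ (ind (b x))) (count-++ b xs ys)) (sym (+-assoc (ind (b x)) _ _))

count-map : ∀ {A B : Set} (b : B → Bool) (f : A → B) xs → count b (map f xs) ≡ count (b ∘ f) xs
count-map b f []       = refl
count-map b f (x ∷ xs) = cong (_+_ (ind (b (f x)))) (count-map b f xs)

count-ext : ∀ {A : Set} {b c : A → Bool} xs → (∀ x → b x ≡ c x) → count b xs ≡ count c xs
count-ext []       e = refl
count-ext (x ∷ xs) e = cong₂ _+_ (cong ind (e x)) (count-ext xs e)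

count-false : ∀ {A : Set} (xs : List A) → count (λ _ → false) xs ≡ 0
count-false []       = refl
count-false (x ∷ xs) = count-false xs

count-∨ : ∀ {A : Set} (b c : A → Bool) xs → (∀ x → b x ≡ true → c x ≡ false)
  → count (λ x → b x ∨ c x) xs ≡ count b xs + count c xs
count-∨ b c []       disj = refl
count-∨ b c (x ∷ xs) disj with b x in bx | c x in cx
... | true  | true  = true≢false cx (disj x bx)
... | true  | false = cong suc (count-∨ b c xs disj)
... | false | true  = trans (cong suc (count-∨ b c xs disj)) (sym (+-suc _ _))
... | false | false = count-∨ b c xs disj

count-∧-< : ∀ {A : Set} (b c : A → Bool) xs → count (λ x → b x ∧ c x) xs < count c xs
  → ∃ λ x → c x ≡ true × b x ≡ false
count-∧-< b c (x ∷ xs) lt with c x in cx | b x in bx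
... | true  | false = x , cx , bx
... | true  | true  = count-∧-< b c xs (ℕP.≤-pred lt)
... | false | true  = count-∧-< b c xs lt
... | false | false = count-∧-< b c xs lt

_≟ˢ_ : ∀ {n} → DecidableEquality (Subset n)
_≟ˢ_ = ≡-dec Bool._≟_

count-subsets-suc : ∀ n (b : Subset (suc n) → Bool)
  → count b (subsets (suc n)) ≡ count (b ∘ (false ∷_)) (subsets n) + count (b ∘ (true ∷_)) (subsets n)
count-subsets-suc n b = trans (count-++ b (map (false ∷_) (subsets n)) _)
                                (cong₂ _+_ (count-map b _ (subsets n)) (count-map b _ (subsets n)))

count-size : ∀ n k → count (λ σ → ∣ σ ∣ ≡ᵇ k) (subsets n) ≡ n C k
count-size zero    zero    = refl
count-size zero    (suc k) = refl
count-size (suc n) zero    = trans (count-subsets-suc n (λ σ → ∣ σ ∣ ≡ᵇ zero))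
  (cong₂ _+_ (count-size n zero) (count-false (subsets n)))
count-size (suc n) (suc k) = begin
  count (λ σ → ∣ σ ∣ ≡ᵇ suc k) (subsets (suc n))   ≡⟨ count-subsets-suc n (λ σ → ∣ σ ∣ ≡ᵇ suc k) ⟩
  count (λ σ → ∣ σ ∣ ≡ᵇ suc k) (subsets n) + count (λ σ → ∣ σ ∣ ≡ᵇ k) (subsets n)
    ≡⟨ cong₂ _+_ (count-size n (suc k)) (count-size n k) ⟩
  n C suc k + n C k                               ≡⟨ +-comm (n C suc k) (n C k) ⟩
  n C k + n C suc k                               ≡⟨ nCk+nC[k+1]≡[n+1]C[k+1] n k ⟩
  suc n C suc k                                   ∎
  where open ≡-Reasoning

count-≟ : ∀ {n} (t : Subset n) (s : Subset n → Bool)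
  → count (λ σ → does (σ ≟ˢ t) ∧ s σ) (subsets n) ≡ ind (s t)
count-≟ []          s = +-identityʳ (ind (s []))
count-≟ {suc n} (true ∷ t)  s = trans (count-subsets-suc n (λ σ → does (σ ≟ˢ (true ∷ t)) ∧ s σ))
  (cong₂ _+_ (count-false (subsets n)) (count-≟ t (s ∘ (true ∷_))))
count-≟ {suc n} (false ∷ t) s = trans (count-subsets-suc n (λ σ → does (σ ≟ˢ (false ∷ t)) ∧ s σ))
  (trans (cong₂ _+_ (count-≟ t (s ∘ (false ∷_))) (count-false (subsets n))) (+-identityʳ _))

listed : ∀ {n} → Subset n → List (Subset n) → Bool
listed σ ts = does (any? (σ ≟ˢ_) ts)

count-extend : ∀ {n} (b : Subset n → Bool) (s : Subset n → Bool) (new : List (Subset n))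
  → Unique new → All (λ t → b t ≡ false) new
  → count (λ σ → (b σ ∨ listed σ new) ∧ s σ) (subsets n) ≡ count (λ σ → b σ ∧ s σ) (subsets n) + count s new
count-extend b s [] _ _ = trans (count-ext (subsets _) (λ σ → cong (_∧ s σ) (∨-identityʳ (b σ)))) (sym (+-identityʳ _))
count-extend {n} b s (t ∷ ts) (t∉ts ∷ uniq) (bt All.∷ bts) = begin
  count (λ σ → (b σ ∨ listed σ (t ∷ ts)) ∧ s σ) (subsets n)
    ≡⟨ count-ext (subsets n) (λ σ → cong (_∧ s σ) (sym (∨-assoc (b σ) _ _))) ⟩
  count (λ σ → (b⁺ σ ∨ listed σ ts) ∧ s σ) (subsets n)
    ≡⟨ count-extend b⁺ s ts uniq (All.zipWith fresh (t∉ts , bts)) ⟩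
  count (λ σ → b⁺ σ ∧ s σ) (subsets n) + count s ts
    ≡⟨ cong (_+ count s ts) split ⟩
  (count (λ σ → b σ ∧ s σ) (subsets n) + ind (s t)) + count s ts
    ≡⟨ +-assoc _ (ind (s t)) (count s ts) ⟩
  count (λ σ → b σ ∧ s σ) (subsets n) + count s (t ∷ ts) ∎
  where
  open ≡-Reasoning
  b⁺ : Subset n → Bool
  b⁺ σ = b σ ∨ does (σ ≟ˢ t)
  fresh : ∀ {u} → ¬ t ≡ u × b u ≡ false → b⁺ u ≡ false
  fresh {u} (t≢u , bu) rewrite bu = dec-false (u ≟ˢ t) (t≢u ∘ sym)
  split : count (λ σ → b⁺ σ ∧ s σ) (subsets n) ≡ count (λ σ → b σ ∧ s σ) (subsets n) + ind (s t)
  split = trans (count-ext (subsets n) (λ σ → ∧-distribʳ-∨ (s σ) (b σ) _))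
    (trans (count-∨ _ _ (subsets n) disjoint) (cong (_+_ _) (count-≟ t s)))
    where
    disjoint : ∀ σ → b σ ∧ s σ ≡ true → does (σ ≟ˢ t) ∧ s σ ≡ false
    disjoint σ e with σ ≟ˢ t
    ... | no _ = refl
    ... | yes refl rewrite bt = true≢false e refl

pair : ∀ {n} → Fin n → Fin n → Subset n
pair a c = ⁅ a ⁆ ∪ ⁅ c ⁆

triple : ∀ {n} → Fin n → Fin n → Fin n → Subset n
triple p q r = ⁅ p ⁆ ∪ pair q r

∣⁅x⁆∪σ∣ : ∀ {n} (x : Fin n) (σ : Subset n) → x ∉ σ → ∣ ⁅ x ⁆ ∪ σ ∣ ≡ suc ∣ σ ∣
∣⁅x⁆∪σ∣ zero    (true ∷ σ)  x∉σ = contradiction here x∉σ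
∣⁅x⁆∪σ∣ zero    (false ∷ σ) x∉σ = cong (suc ∘ ∣_∣) (∪-identityˡ σ)
∣⁅x⁆∪σ∣ (suc x) (true ∷ σ)  x∉σ = cong suc (∣⁅x⁆∪σ∣ x σ (x∉σ ∘ there))
∣⁅x⁆∪σ∣ (suc x) (false ∷ σ) x∉σ = ∣⁅x⁆∪σ∣ x σ (x∉σ ∘ there)

module _ {n : ℕ} where

  ⁅⁆⊆ : ∀ {a : Fin n} {σ : Subset n} → a ∈ σ → ⁅ a ⁆ ⊆ σ
  ⁅⁆⊆ {σ = σ} a∈σ x∈⁅a⁆ = subst (_∈ σ) (sym (x∈⁅y⁆⇒x≡y _ x∈⁅a⁆)) a∈σ

  ∪-least : ∀ {τ ρ σ : Subset n} → τ ⊆ σ → ρ ⊆ σ → τ ∪ ρ ⊆ σ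
  ∪-least {τ} {ρ} τ⊆σ ρ⊆σ x∈ with x∈p∪q⁻ τ ρ x∈
  ... | inj₁ x∈τ = τ⊆σ x∈τ
  ... | inj₂ x∈ρ = ρ⊆σ x∈ρ

  drop-⁅⁆ : ∀ {x : Fin n} {τ σ : Subset n} → σ ⊆ ⁅ x ⁆ ∪ τ → x ∉ σ → σ ⊆ τ
  drop-⁅⁆ {x} {τ} {σ} σ⊆ x∉σ {y} y∈σ with x∈p∪q⁻ ⁅ x ⁆ τ (σ⊆ y∈σ)
  ... | inj₁ y∈⁅x⁆ = contradiction (subst (_∈ σ) (x∈⁅y⁆⇒x≡y x y∈⁅x⁆) y∈σ) x∉σ
  ... | inj₂ y∈τ  = y∈τ

  ∈-pair⁻ : ∀ {x a c : Fin n} → x ∈ pair a c → x ≡ a ⊎ x ≡ c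
  ∈-pair⁻ {a = a} {c} x∈ with x∈p∪q⁻ ⁅ a ⁆ ⁅ c ⁆ x∈
  ... | inj₁ x∈⁅a⁆ = inj₁ (x∈⁅y⁆⇒x≡y a x∈⁅a⁆)
  ... | inj₂ x∈⁅c⁆ = inj₂ (x∈⁅y⁆⇒x≡y c x∈⁅c⁆)

  ∈-pairˡ : ∀ (a c : Fin n) → a ∈ pair a c
  ∈-pairˡ a c = p⊆p∪q ⁅ c ⁆ (x∈⁅x⁆ a)

  ∈-pairʳ : ∀ (a c : Fin n) → c ∈ pair a c
  ∈-pairʳ a c = q⊆p∪q ⁅ a ⁆ ⁅ c ⁆ (x∈⁅x⁆ c)

  pair⊆ : ∀ {a c : Fin n} {σ : Subset n} → a ∈ σ → c ∈ σ → pair a c ⊆ σ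
  pair⊆ a∈σ c∈σ = ∪-least (⁅⁆⊆ a∈σ) (⁅⁆⊆ c∈σ)

  pair-comm : ∀ (a c : Fin n) → pair a c ≡ pair c a
  pair-comm a c = ∪-comm ⁅ a ⁆ ⁅ c ⁆

  ∉-pair : ∀ {x a c : Fin n} → ¬ x ≡ a → ¬ x ≡ c → x ∉ pair a c
  ∉-pair x≢a x≢c x∈ with ∈-pair⁻ x∈
  ... | inj₁ x≡a = x≢a x≡a
  ... | inj₂ x≡c = x≢c x≡c

  triple-q : ∀ (p q r : Fin n) → triple p q r ≡ ⁅ q ⁆ ∪ pair p r
  triple-q p q r = begin
    ⁅ p ⁆ ∪ (⁅ q ⁆ ∪ ⁅ r ⁆)  ≡⟨ sym (∪-assoc ⁅ p ⁆ ⁅ q ⁆ ⁅ r ⁆) ⟩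
    (⁅ p ⁆ ∪ ⁅ q ⁆) ∪ ⁅ r ⁆  ≡⟨ cong (_∪ ⁅ r ⁆) (∪-comm ⁅ p ⁆ ⁅ q ⁆) ⟩
    (⁅ q ⁆ ∪ ⁅ p ⁆) ∪ ⁅ r ⁆  ≡⟨ ∪-assoc ⁅ q ⁆ ⁅ p ⁆ ⁅ r ⁆ ⟩
    ⁅ q ⁆ ∪ (⁅ p ⁆ ∪ ⁅ r ⁆)  ∎
    where open ≡-Reasoning

  triple-r : ∀ (p q r : Fin n) → triple p q r ≡ ⁅ r ⁆ ∪ pair p q
  triple-r p q r = trans (sym (∪-assoc ⁅ p ⁆ ⁅ q ⁆ ⁅ r ⁆)) (∪-comm (pair p q) ⁅ r ⁆)

  triple⊆ : ∀ {p q r : Fin n} {σ : Subset n} → p ∈ σ → q ∈ σ → r ∈ σ → triple p q r ⊆ σ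
  triple⊆ p∈σ q∈σ r∈σ = ∪-least (⁅⁆⊆ p∈σ) (pair⊆ q∈σ r∈σ)

  ∣pair∣ : ∀ {a c : Fin n} → ¬ a ≡ c → ∣ pair a c ∣ ≡ 2
  ∣pair∣ {a} {c} a≢c = trans (∣⁅x⁆∪σ∣ a ⁅ c ⁆ (a≢c ∘ x∈⁅y⁆⇒x≡y c)) (cong suc (∣⁅x⁆∣≡1 c))

  ∣triple∣ : ∀ {p q r : Fin n} → ¬ p ≡ q → ¬ q ≡ r → ¬ p ≡ r → ∣ triple p q r ∣ ≡ 3
  ∣triple∣ {p} {q} {r} p≢q q≢r p≢r = trans (∣⁅x⁆∪σ∣ p (pair q r) (∉-pair p≢q p≢r)) (cong suc (∣pair∣ q≢r))

≢-by : ∀ {n} {x : Fin n} {σ τ : Subset n} → x ∉ σ → x ∈ τ → ¬ σ ≡ τ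
≢-by x∉σ x∈τ refl = x∉σ x∈τ

size-0 : ∀ {n} (σ : Subset n) → ∣ σ ∣ ≡ 0 → σ ≡ ⊥
size-0 []          _ = refl
size-0 (false ∷ σ) e = cong (false ∷_) (size-0 σ e)

size-1 : ∀ {n} (σ : Subset n) → ∣ σ ∣ ≡ 1 → ∃ λ i → σ ≡ ⁅ i ⁆
size-1 (true ∷ σ)  e = zero , cong (true ∷_) (size-0 σ (ℕP.suc-injective e))
size-1 (false ∷ σ) e with size-1 σ e
... | i , refl = suc i , refl

size-2 : ∀ {n} (σ : Subset n) → ∣ σ ∣ ≡ 2 → ∃₂ λ a c → ¬ a ≡ c × σ ≡ pair a c
size-2 (true ∷ σ)  e with size-1 σ (ℕP.suc-injective e)
... | i , refl = zero , suc i , (λ ()) , cong (true ∷_) (sym (∪-identityˡ ⁅ i ⁆))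
size-2 (false ∷ σ) e with size-2 σ e
... | a , c , a≢c , refl = suc a , suc c , a≢c ∘ FinP.suc-injective , refl

module _ {n : ℕ} where

  ⊆-⁅⁆⁻ : ∀ {a : Fin n} {σ : Subset n} → σ ⊆ ⁅ a ⁆ → σ ≡ ⊥ ⊎ σ ≡ ⁅ a ⁆
  ⊆-⁅⁆⁻ {a} {σ} σ⊆ with a ∈? σ
  ... | yes a∈σ = inj₂ (⊆-antisym σ⊆ (⁅⁆⊆ a∈σ))
  ... | no  a∉σ = inj₁ (Empty-unique λ { (x , x∈σ) → a∉σ (subst (_∈ σ) (x∈⁅y⁆⇒x≡y a (σ⊆ x∈σ)) x∈σ) })

  ⊆-pair⁻ : ∀ {a c : Fin n} {σ : Subset n} → σ ⊆ pair a c
    → Any (σ ≡_) (⊥ ∷ ⁅ a ⁆ ∷ ⁅ c ⁆ ∷ pair a c ∷ [])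
  ⊆-pair⁻ {a} {c} {σ} σ⊆ with c ∈? σ | a ∈? σ
  ... | no c∉σ | _ with ⊆-⁅⁆⁻ (drop-⁅⁆ (subst (σ ⊆_) (pair-comm a c) σ⊆) c∉σ)
  ...   | inj₁ σ≡⊥ = here σ≡⊥
  ...   | inj₂ σ≡a = there (here σ≡a)
  ⊆-pair⁻ {a} {c} {σ} σ⊆ | yes c∈σ | no a∉σ with ⊆-⁅⁆⁻ (drop-⁅⁆ σ⊆ a∉σ)
  ...   | inj₁ σ≡⊥ = here σ≡⊥
  ...   | inj₂ σ≡c = there (there (here σ≡c))
  ⊆-pair⁻ σ⊆ | yes c∈σ | yes a∈σ = there (there (there (here (⊆-antisym σ⊆ (pair⊆ a∈σ c∈σ)))))

  ⊆-triple⁻ : ∀ {p q r : Fin n} {σ : Subset n} → σ ⊆ triple p q r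
    → σ ⊆ pair p q ⊎ σ ⊆ pair q r ⊎ σ ≡ pair p r ⊎ σ ≡ triple p q r
  ⊆-triple⁻ {p} {q} {r} {σ} σ⊆ with p ∈? σ | r ∈? σ | q ∈? σ
  ... | no p∉σ  | _       | _       = inj₂ (inj₁ (drop-⁅⁆ σ⊆ p∉σ))
  ... | yes p∈σ | no r∉σ  | _       = inj₁ (drop-⁅⁆ (subst (σ ⊆_) (triple-r p q r) σ⊆) r∉σ)
  ... | yes p∈σ | yes r∈σ | no q∉σ  =
    inj₂ (inj₂ (inj₁ (⊆-antisym (drop-⁅⁆ (subst (σ ⊆_) (triple-q p q r) σ⊆) q∉σ) (pair⊆ p∈σ r∈σ))))
  ... | yes p∈σ | yes r∈σ | yes q∈σ = inj₂ (inj₂ (inj₂ (⊆-antisym σ⊆ (triple⊆ p∈σ q∈σ r∈σ))))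

module _ {n : ℕ} where

  walk-map : ∀ {F G : Pred (Subset n) _} → (∀ {σ} → F σ → G σ) → ∀ {u w} → Reach F u w → Reach G u w
  walk-map f here        = here
  walk-map f (step e ws) = step (f e) (walk-map f ws)

  walk-++ : ∀ {F : Pred (Subset n) _} {u v w} → Reach F u v → Reach F v w → Reach F u w
  walk-++ here        ws′ = ws′
  walk-++ (step e ws) ws′ = step e (walk-++ ws ws′)

  walk-sym : ∀ {F : Pred (Subset n) _} {u w} → Reach F u w → Reach F w u
  walk-sym here = here
  walk-sym {F} {u} (step {v = v} e ws) = walk-++ (walk-sym ws) (step (subst F (pair-comm u v) e) here)

walk-suc : ∀ {n} {F : Pred (Subset n) _} {G : Pred (Subset (suc n)) _}
  → (∀ {σ} → F σ → G (false ∷ σ)) → ∀ {u w} → Reach F u w → Reach G (suc u) (suc w)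
walk-suc f here        = here
walk-suc f (step e ws) = step (f e) (walk-suc f ws)

connected-via : ∀ {m n} {F : Pred (Subset m) _} {G : Pred (Subset n) _} (ι : Fin m → Fin n)
  → (∀ {u w} → Reach F u w → Reach G (ι u) (ι w))
  → (∀ s → G ⁅ s ⁆ → ∃ λ s′ → F ⁅ s′ ⁆ × Reach G s (ι s′))
  → Connected F → Connected G
connected-via ι embed reach cF u w Gu Gw with reach u Gu | reach w Gw
... | u′ , Fu′ , u↝ | w′ , Fw′ , w↝ = walk-++ u↝ (walk-++ (embed (cF u′ w′ Fu′ Fw′)) (walk-sym w↝))

connected-hub : ∀ {n} {G : Pred (Subset n) _} (hub : Fin n) → (∀ s → G ⁅ s ⁆ → Reach G s hub) → Connected G
connected-hub hub reach u w Gu Gw = walk-++ (reach u Gu) (walk-sym (reach w Gw))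

faceCount-count : ∀ {n} (Δ : Complex n) k → faceCount Δ k ≡ count (λ σ → face Δ σ ∧ (∣ σ ∣ ≡ᵇ k)) (subsets n)
faceCount-count {n} Δ k = length-filter (λ σ → face Δ σ ∧ (∣ σ ∣ ≡ᵇ k)) (subsets n)

-- f₀ = n: every singleton is a face.
vertexCount : ∀ {n} (Δ : Complex n) → faceCount Δ 1 ≡ n
vertexCount {n} Δ = begin
  faceCount Δ 1                                   ≡⟨ faceCount-count Δ 1 ⟩
  count (λ σ → face Δ σ ∧ (∣ σ ∣ ≡ᵇ 1)) (subsets n) ≡⟨ count-ext (subsets n) singleton-face ⟩
  count (λ σ → ∣ σ ∣ ≡ᵇ 1) (subsets n)              ≡⟨ count-size n 1 ⟩
  n C 1                                           ≡⟨ nC1≡n n ⟩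
  n                                               ∎
  where
  open ≡-Reasoning
  singleton-face : ∀ σ → face Δ σ ∧ (∣ σ ∣ ≡ᵇ 1) ≡ (∣ σ ∣ ≡ᵇ 1)
  singleton-face σ with ∣ σ ∣ ≡ᵇ 1 in size
  ... | false = ∧-zeroʳ (face Δ σ)
  ... | true with size-1 σ (ℕP.≡ᵇ⇒≡ ∣ σ ∣ 1 (subst Bool.T (sym size) _))
  ...   | i , refl = cong (_∧ true) (singletons Δ i)

h-shift : ∀ {m n} (Δ : Complex m) (Γ : Complex n) (d₀ d₁ d₂ : ℕ)
  → faceCount Γ 1 ≡ faceCount Δ 1 + d₀ → faceCount Γ 2 ≡ faceCount Δ 2 + d₁ → faceCount Γ 3 ≡ faceCount Δ 3 + d₂
  → h₁ Γ ≡ + d₀ ℤ.+ h₁ Δ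
  × h₂ Γ ≡ (+ d₁ ℤ.- + 2 ℤ.* + d₀) ℤ.+ h₂ Δ
  × h₃ Γ ≡ (+ d₂ ℤ.- + d₁ ℤ.+ + d₀) ℤ.+ h₃ Δ
h-shift Δ Γ d₀ d₁ d₂ e₀ e₁ e₂
  rewrite e₀ | e₁ | e₂ | ℤP.pos-+ (faceCount Δ 1) d₀ | ℤP.pos-+ (faceCount Δ 2) d₁ | ℤP.pos-+ (faceCount Δ 3) d₂ =
  shift₁ (+ faceCount Δ 1) (+ d₀) ,
  shift₂ (+ faceCount Δ 1) (+ faceCount Δ 2) (+ d₀) (+ d₁) ,
  shift₃ (+ faceCount Δ 1) (+ faceCount Δ 2) (+ faceCount Δ 3) (+ d₀) (+ d₁) (+ d₂)
  where
  shift₁ : ∀ f₀ d₀ → (f₀ ℤ.+ d₀) ℤ.- + 3 ≡ d₀ ℤ.+ (f₀ ℤ.- + 3)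
  shift₁ = solve-∀
  shift₂ : ∀ f₀ f₁ d₀ d₁ → (f₁ ℤ.+ d₁) ℤ.- + 2 ℤ.* (f₀ ℤ.+ d₀) ℤ.+ + 3
                         ≡ (d₁ ℤ.- + 2 ℤ.* d₀) ℤ.+ (f₁ ℤ.- + 2 ℤ.* f₀ ℤ.+ + 3)
  shift₂ = solve-∀
  shift₃ : ∀ f₀ f₁ f₂ d₀ d₁ d₂ → (f₂ ℤ.+ d₂) ℤ.- (f₁ ℤ.+ d₁) ℤ.+ (f₀ ℤ.+ d₀) ℤ.- + 1
                               ≡ (d₂ ℤ.- d₁ ℤ.+ d₀) ℤ.+ (f₂ ℤ.- f₁ ℤ.+ f₀ ℤ.- + 1)
  shift₃ = solve-∀

Good : ∀ {n} → Complex n → Set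
Good Δ = TwoDim Δ × Connected (faces Δ) × Buchsbaum Δ

-- The ear move: a new vertex 0 coned over an edge {a,c} of Δ (the old vertices are
-- shifted by one).  It adds the faces {0}, {0,a}, {0,c}, {0,a,c}.
module Ear {n : ℕ} (Δ : Complex n) {a c : Fin n} (a≢c : ¬ a ≡ c) (ac∈Δ : pair a c ∈Δ Δ) where

  earFace : Subset (suc n) → Bool
  earFace (false ∷ σ) = face Δ σ
  earFace (true ∷ σ)  = does (σ ⊆? pair a c)

  earFace-⊆ : ∀ σ τ → σ ⊆ τ → earFace τ ≡ true → earFace σ ≡ true
  earFace-⊆ (false ∷ σ) (false ∷ τ) σ⊆τ τ∈ = downClosed Δ σ τ (drop-∷-⊆ σ⊆τ) τ∈
  earFace-⊆ (true ∷ σ)  (false ∷ τ) σ⊆τ τ∈ with σ⊆τ here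
  ... | ()
  earFace-⊆ (false ∷ σ) (true ∷ τ)  σ⊆τ τ∈ =
    downClosed Δ σ (pair a c) (⊆-trans (drop-∷-⊆ σ⊆τ) (does⁻ (τ ⊆? pair a c) τ∈)) ac∈Δ
  earFace-⊆ (true ∷ σ)  (true ∷ τ)  σ⊆τ τ∈ =
    dec-true (σ ⊆? pair a c) (⊆-trans (drop-∷-⊆ σ⊆τ) (does⁻ (τ ⊆? pair a c) τ∈))

  Γ : Complex (suc n)
  Γ = record { face = earFace ; singletons = singleton ; downClosed = earFace-⊆ }
    where
    singleton : ∀ i → earFace ⁅ i ⁆ ≡ true
    singleton zero    = dec-true (⊥ ⊆? pair a c) ⊥⊆
    singleton (suc i) = singletons Δ i

  base : List (Subset n)
  base = ⊥ ∷ ⁅ a ⁆ ∷ ⁅ c ⁆ ∷ pair a c ∷ []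

  base-unique : Unique base
  base-unique = (≢-by ∉⊥ (x∈⁅x⁆ a) All.∷ ≢-by ∉⊥ (x∈⁅x⁆ c) All.∷ ≢-by ∉⊥ (∈-pairˡ a c) All.∷ All.[])
              ∷ (≢-by c∉⁅a⁆ (x∈⁅x⁆ c) All.∷ ≢-by c∉⁅a⁆ (∈-pairʳ a c) All.∷ All.[])
              ∷ (≢-by (a≢c ∘ x∈⁅y⁆⇒x≡y c) (∈-pairˡ a c) All.∷ All.[])
              ∷ All.[] ∷ []
    where
    c∉⁅a⁆ : c ∉ ⁅ a ⁆
    c∉⁅a⁆ c∈ = a≢c (sym (x∈⁅y⁆⇒x≡y a c∈))

  ⊆-pair⇔listed : ∀ σ → does (σ ⊆? pair a c) ≡ listed σ base
  ⊆-pair⇔listed σ = bool-ext (λ e → dec-true (any? (σ ≟ˢ_) base) (⊆-pair⁻ (does⁻ (σ ⊆? pair a c) e)))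
                             (λ e → dec-true (σ ⊆? pair a c) (listed⇒⊆ (does⁻ (any? (σ ≟ˢ_) base) e)))
    where
    listed⇒⊆ : Any (σ ≡_) base → σ ⊆ pair a c
    listed⇒⊆ (here refl)                         = ⊥⊆
    listed⇒⊆ (there (here refl))                 = ⁅⁆⊆ (∈-pairˡ a c)
    listed⇒⊆ (there (there (here refl)))         = ⁅⁆⊆ (∈-pairʳ a c)
    listed⇒⊆ (there (there (there (here refl)))) = id

  cone-sizes : ℕ → ℕ
  cone-sizes k = ind (1 ≡ᵇ k) + (ind (2 ≡ᵇ k) + (ind (2 ≡ᵇ k) + (ind (3 ≡ᵇ k) + 0)))

  base-sizes : ∀ k → count (λ t → suc ∣ t ∣ ≡ᵇ k) base ≡ cone-sizes k
  base-sizes k rewrite ∣⊥∣≡0 n | ∣⁅x⁆∣≡1 a | ∣⁅x⁆∣≡1 c | ∣pair∣ a≢c = refl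

  faceCount-ear : ∀ k → faceCount Γ k ≡ faceCount Δ k + cone-sizes k
  faceCount-ear k = begin
    faceCount Γ k
      ≡⟨ trans (faceCount-count Γ k) (count-subsets-suc n (λ σ → earFace σ ∧ (∣ σ ∣ ≡ᵇ k))) ⟩
    count (λ σ → face Δ σ ∧ (∣ σ ∣ ≡ᵇ k)) (subsets n) + count (λ σ → does (σ ⊆? pair a c) ∧ s σ) (subsets n)
      ≡⟨ cong₂ _+_ (sym (faceCount-count Δ k)) (count-ext (subsets n) (λ σ → cong (_∧ s σ) (⊆-pair⇔listed σ))) ⟩
    faceCount Δ k + count (λ σ → (false ∨ listed σ base) ∧ s σ) (subsets n)
      ≡⟨ cong (_+_ (faceCount Δ k)) (count-extend (λ _ → false) s base base-unique nothing-old) ⟩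
    faceCount Δ k + (count (λ _ → false) (subsets n) + count s base)
      ≡⟨ cong (λ m → faceCount Δ k + (m + count s base)) (count-false (subsets n)) ⟩
    faceCount Δ k + count s base
      ≡⟨ cong (_+_ (faceCount Δ k)) (base-sizes k) ⟩
    faceCount Δ k + cone-sizes k ∎
    where
    open ≡-Reasoning
    s : Subset n → Bool
    s σ = suc ∣ σ ∣ ≡ᵇ k
    nothing-old : All (λ _ → false ≡ false) base
    nothing-old = All.universal (λ _ → refl) base

  h-ear : h₁ Γ ≡ + 1 ℤ.+ h₁ Δ × h₂ Γ ≡ h₂ Δ × h₃ Γ ≡ h₃ Δ
  h-ear =
    let e₁ , e₂ , e₃ = h-shift Δ Γ 1 2 1 (faceCount-ear 1) (faceCount-ear 2) (faceCount-ear 3)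
    in  e₁ , trans e₂ (ℤP.+-identityˡ (h₂ Δ)) , trans e₃ (ℤP.+-identityˡ (h₃ Δ))

  -- Dimension and purity: the only new facet is {0,a,c}.
  ear-twoDim : TwoDim Δ → TwoDim Γ
  ear-twoDim ((τ , τ∈Δ , ∣τ∣≡3) , small) = (false ∷ τ , τ∈Δ , ∣τ∣≡3) , small′
    where
    small′ : ∀ σ → σ ∈Δ Γ → ∣ σ ∣ ≤ 3
    small′ (false ∷ σ) σ∈ = small σ σ∈
    small′ (true ∷ σ)  σ∈ = s≤s (subst (∣ σ ∣ ≤_) (∣pair∣ a≢c) (p⊆q⇒∣p∣≤∣q∣ (does⁻ (σ ⊆? pair a c) σ∈)))

  ear-pure : Pure2 Δ → Pure2 Γ
  ear-pure pure (false ∷ σ) σ∈ with pure σ σ∈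
  ... | τ , τ∈ , σ⊆τ , ∣τ∣≡3 = false ∷ τ , τ∈ , s⊆s σ⊆τ , ∣τ∣≡3
  ear-pure pure (true ∷ σ) σ∈ =
    true ∷ pair a c , dec-true (pair a c ⊆? pair a c) id , s⊆s (does⁻ (σ ⊆? pair a c) σ∈) , cong suc (∣pair∣ a≢c)

  -- Connectivity: 0 is joined to a, and old walks shift.
  ear-connected : Connected (faces Δ) → Connected (faces Γ)
  ear-connected = connected-via suc (walk-suc id) reach
    where
    reach : ∀ s → ⁅ s ⁆ ∈Δ Γ → ∃ λ s′ → ⁅ s′ ⁆ ∈Δ Δ × Reach (faces Γ) s (suc s′)
    reach zero    _ = a , singletons Δ a ,
                      step (dec-true (⊥ ∪ ⁅ a ⁆ ⊆? pair a c) (∪-least ⊥⊆ (⁅⁆⊆ (∈-pairˡ a c)))) here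
    reach (suc s) _ = s , singletons Δ s , here

  -- Links: lk 0 is the edge {a,c}; lk v for old v is the old link, plus the edge
  -- {0,c} (if v = a) or {0,a} (if v = c), attached at the old link vertex c resp. a.
  lift-link : ∀ {v} {G : Subset n} → lk Δ v G → lk Γ (suc v) (false ∷ G)
  lift-link (v∉G , G∈) = (λ { (there v∈G) → v∉G v∈G }) , G∈

  link-0 : Connected (lk Γ zero)
  link-0 = connected-hub (suc a) reach
    where
    reach : ∀ s → lk Γ zero ⁅ s ⁆ → Reach (lk Γ zero) s (suc a)
    reach zero    (0∉ , _) = contradiction here 0∉
    reach (suc s) (_ , s∈) with ∈-pair⁻ (does⁻ (⁅ s ⁆ ∪ ⊥ ⊆? pair a c) s∈ (p⊆p∪q ⊥ (x∈⁅x⁆ s)))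
    ... | inj₁ refl = here
    ... | inj₂ refl = step ((λ ()) , dec-true (pair c a ∪ ⊥ ⊆? pair a c) ca⊆) here
      where ca⊆ : pair c a ∪ ⊥ ⊆ pair a c
            ca⊆ = ∪-least (pair⊆ (∈-pairʳ a c) (∈-pairˡ a c)) ⊥⊆

  0-to-other : ∀ {x y} → x ∈ pair a c → y ∈ pair a c → ¬ x ≡ y → pair y x ∈Δ Δ
    → ∃ λ s′ → lk Δ x ⁅ s′ ⁆ × Reach (lk Γ (suc x)) zero (suc s′)
  0-to-other {x} {y} x∈ y∈ x≢y yx∈Δ =
    y , ((x≢y ∘ x∈⁅y⁆⇒x≡y y) , yx∈Δ) , step (x∉ , dec-true ((⊥ ∪ ⁅ y ⁆) ∪ ⁅ x ⁆ ⊆? pair a c) ⊆ac) here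
    where
    x∉ : suc x ∉ ⁅ zero ⁆ ∪ ⁅ suc y ⁆
    x∉ (there x∈⊥y) with x∈p∪q⁻ ⊥ ⁅ y ⁆ x∈⊥y
    ... | inj₁ x∈⊥ = ∉⊥ x∈⊥
    ... | inj₂ x∈y = x≢y (x∈⁅y⁆⇒x≡y y x∈y)
    ⊆ac : (⊥ ∪ ⁅ y ⁆) ∪ ⁅ x ⁆ ⊆ pair a c
    ⊆ac = ∪-least (∪-least ⊥⊆ (⁅⁆⊆ y∈)) (⁅⁆⊆ x∈)

  link-old : ∀ v → Connected (lk Δ v) → Connected (lk Γ (suc v))
  link-old v = connected-via suc (walk-suc lift-link) reach
    where
    reach : ∀ s → lk Γ (suc v) ⁅ s ⁆ → ∃ λ s′ → lk Δ v ⁅ s′ ⁆ × Reach (lk Γ (suc v)) s (suc s′)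
    reach (suc s) (v∉ , s∈) = s , ((v∉ ∘ there) , s∈) , here
    reach zero    (_ , 0v∈) with ∈-pair⁻ (does⁻ (⊥ ∪ ⁅ v ⁆ ⊆? pair a c) 0v∈ (q⊆p∪q ⊥ ⁅ v ⁆ (x∈⁅x⁆ v)))
    ... | inj₁ refl = 0-to-other (∈-pairˡ a c) (∈-pairʳ a c) a≢c (subst (_∈Δ Δ) (pair-comm a c) ac∈Δ)
    ... | inj₂ refl = 0-to-other (∈-pairʳ a c) (∈-pairˡ a c) (a≢c ∘ sym) ac∈Δ

  ear-good : Good Δ → Good Γ
  ear-good (dim , conn , pure , links) = ear-twoDim dim , ear-connected conn , ear-pure pure , links′
    where
    links′ : ∀ v → Connected (lk Γ v)
    links′ zero    = link-0
    links′ (suc v) = link-old v (links v)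

module Fill {n : ℕ} (Δ : Complex n) {p q r : Fin n} (p≢q : ¬ p ≡ q) (q≢r : ¬ q ≡ r) (p≢r : ¬ p ≡ r)
  (pq∈Δ : pair p q ∈Δ Δ) (qr∈Δ : pair q r ∈Δ Δ) (pr∉Δ : face Δ (pair p r) ≡ false) where

  pqr : Subset n
  pqr = triple p q r

  p∈pqr : p ∈ pqr
  p∈pqr = p⊆p∪q (pair q r) (x∈⁅x⁆ p)

  q∈pqr : q ∈ pqr
  q∈pqr = q⊆p∪q ⁅ p ⁆ (pair q r) (∈-pairˡ q r)

  r∈pqr : r ∈ pqr
  r∈pqr = q⊆p∪q ⁅ p ⁆ (pair q r) (∈-pairʳ q r)

  fillFace : Subset n → Bool
  fillFace σ = face Δ σ ∨ does (σ ⊆? pqr)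

  fillFace-⊆ : ∀ σ τ → σ ⊆ τ → fillFace τ ≡ true → fillFace σ ≡ true
  fillFace-⊆ σ τ σ⊆τ τ∈ with ∨-elim (face Δ τ) τ∈
  ... | inj₁ τ∈Δ   = ∨-introˡ (downClosed Δ σ τ σ⊆τ τ∈Δ)
  ... | inj₂ τ⊆pqr = ∨-introʳ (face Δ σ) (dec-true (σ ⊆? pqr) (⊆-trans σ⊆τ (does⁻ (τ ⊆? pqr) τ⊆pqr)))

  Γ : Complex n
  Γ = record { face = fillFace ; singletons = ∨-introˡ ∘ singletons Δ ; downClosed = fillFace-⊆ }

  -- Since {p,q} and {q,r} are faces of Δ, a subset of {p,q,r} outside Δ is {p,r} or {p,q,r}.
  new-face : ∀ {σ} → σ ⊆ pqr → face Δ σ ≡ false → σ ≡ pair p r ⊎ σ ≡ pqr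
  new-face {σ} σ⊆ σ∉Δ with ⊆-triple⁻ σ⊆
  ... | inj₁ σ⊆pq        = true≢false (downClosed Δ σ (pair p q) σ⊆pq pq∈Δ) σ∉Δ
  ... | inj₂ (inj₁ σ⊆qr) = true≢false (downClosed Δ σ (pair q r) σ⊆qr qr∈Δ) σ∉Δ
  ... | inj₂ (inj₂ σ≡)   = σ≡

  added : List (Subset n)
  added = pair p r ∷ pqr ∷ []

  -- {p,q,r} is not a face of Δ, since its subset {p,r} is not.
  pqr∉Δ : face Δ pqr ≡ false
  pqr∉Δ with face Δ pqr in pqr∈Δ
  ... | false = refl
  ... | true  = true≢false (downClosed Δ (pair p r) pqr (pair⊆ p∈pqr r∈pqr) pqr∈Δ) pr∉Δ

  added-unique : Unique added
  added-unique = (≢-by (∉-pair (p≢q ∘ sym) q≢r) q∈pqr All.∷ All.[]) ∷ All.[] ∷ []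

  ⊆-pqr⇔listed : ∀ σ → face Δ σ ≡ false → does (σ ⊆? pqr) ≡ listed σ added
  ⊆-pqr⇔listed σ σ∉Δ = bool-ext
    (λ e → dec-true (any? (σ ≟ˢ_) added) (as-listed (new-face (does⁻ (σ ⊆? pqr) e) σ∉Δ)))
    (λ e → dec-true (σ ⊆? pqr) (listed⇒⊆ (does⁻ (any? (σ ≟ˢ_) added) e)))
    where
    as-listed : σ ≡ pair p r ⊎ σ ≡ pqr → Any (σ ≡_) added
    as-listed (inj₁ σ≡pr)  = here σ≡pr
    as-listed (inj₂ σ≡pqr) = there (here σ≡pqr)
    listed⇒⊆ : Any (σ ≡_) added → σ ⊆ pqr
    listed⇒⊆ (here refl)         = pair⊆ p∈pqr r∈pqr
    listed⇒⊆ (there (here refl)) = id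

  fillFace⇔listed : ∀ σ → fillFace σ ≡ face Δ σ ∨ listed σ added
  fillFace⇔listed σ with face Δ σ in σ∈Δ
  ... | true  = refl
  ... | false = ⊆-pqr⇔listed σ σ∈Δ

  fill-sizes : ℕ → ℕ
  fill-sizes k = ind (2 ≡ᵇ k) + (ind (3 ≡ᵇ k) + 0)

  added-sizes : ∀ k → count (λ t → ∣ t ∣ ≡ᵇ k) added ≡ fill-sizes k
  added-sizes k rewrite ∣pair∣ p≢r | ∣triple∣ p≢q q≢r p≢r = refl

  faceCount-fill : ∀ k → faceCount Γ k ≡ faceCount Δ k + fill-sizes k
  faceCount-fill k = begin
    faceCount Γ k
      ≡⟨ faceCount-count Γ k ⟩
    count (λ σ → fillFace σ ∧ s σ) (subsets n)
      ≡⟨ count-ext (subsets n) (λ σ → cong (_∧ s σ) (fillFace⇔listed σ)) ⟩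
    count (λ σ → (face Δ σ ∨ listed σ added) ∧ s σ) (subsets n)
      ≡⟨ count-extend (face Δ) s added added-unique (pr∉Δ All.∷ pqr∉Δ All.∷ All.[]) ⟩
    count (λ σ → face Δ σ ∧ s σ) (subsets n) + count s added
      ≡⟨ cong₂ _+_ (sym (faceCount-count Δ k)) (added-sizes k) ⟩
    faceCount Δ k + fill-sizes k ∎
    where
    open ≡-Reasoning
    s : Subset n → Bool
    s σ = ∣ σ ∣ ≡ᵇ k

  h-fill : h₁ Γ ≡ h₁ Δ × h₂ Γ ≡ + 1 ℤ.+ h₂ Δ × h₃ Γ ≡ h₃ Δ
  h-fill =
    let e₁ , e₂ , e₃ = h-shift Δ Γ 0 1 1 (faceCount-fill 1) (faceCount-fill 2) (faceCount-fill 3)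
    in  trans e₁ (ℤP.+-identityˡ (h₁ Δ)) , e₂ , trans e₃ (ℤP.+-identityˡ (h₃ Δ))

  -- Dimension, purity and connectivity: the new facet is {p,q,r}, and Δ ⊆ Γ.
  fill-twoDim : TwoDim Δ → TwoDim Γ
  fill-twoDim ((τ , τ∈Δ , ∣τ∣≡3) , small) = (τ , ∨-introˡ τ∈Δ , ∣τ∣≡3) , small′
    where
    small′ : ∀ σ → σ ∈Δ Γ → ∣ σ ∣ ≤ 3
    small′ σ σ∈ with ∨-elim (face Δ σ) σ∈
    ... | inj₁ σ∈Δ   = small σ σ∈Δ
    ... | inj₂ σ⊆pqr = subst (∣ σ ∣ ≤_) (∣triple∣ p≢q q≢r p≢r) (p⊆q⇒∣p∣≤∣q∣ (does⁻ (σ ⊆? pqr) σ⊆pqr))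

  fill-pure : Pure2 Δ → Pure2 Γ
  fill-pure pure σ σ∈ with ∨-elim (face Δ σ) σ∈
  ... | inj₁ σ∈Δ with pure σ σ∈Δ
  ...   | τ , τ∈Δ , σ⊆τ , ∣τ∣≡3 = τ , ∨-introˡ τ∈Δ , σ⊆τ , ∣τ∣≡3
  fill-pure pure σ σ∈ | inj₂ σ⊆pqr =
    pqr , ∨-introʳ (face Δ pqr) (dec-true (pqr ⊆? pqr) id) , does⁻ (σ ⊆? pqr) σ⊆pqr , ∣triple∣ p≢q q≢r p≢r

  fill-connected : Connected (faces Δ) → Connected (faces Γ)
  fill-connected conn u w _ _ = walk-map ∨-introˡ (conn u w (singletons Δ u) (singletons Δ w))

  -- Links: the only new link edges are {p,q} in lk r and {r,q} in lk p, both attached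
  -- to the old link vertex q.
  to-q : ∀ {s v} → s ∈ pqr → v ∈ pqr → v ∉ pair s q → ¬ v ≡ q → pair q v ∈Δ Δ
    → ∃ λ s′ → lk Δ v ⁅ s′ ⁆ × Reach (lk Γ v) s s′
  to-q {s} {v} s∈ v∈ v∉sq v≢q qv∈Δ =
    q , ((v≢q ∘ x∈⁅y⁆⇒x≡y q) , qv∈Δ) ,
    step (v∉sq , ∨-introʳ (face Δ _) (dec-true (pair s q ∪ ⁅ v ⁆ ⊆? pqr) (∪-least (pair⊆ s∈ q∈pqr) (⁅⁆⊆ v∈)))) here

  new-link-edge : ∀ {s v} → ¬ s ≡ v → pair s v ≡ pair p r → s ≡ p × v ≡ r ⊎ s ≡ r × v ≡ p
  new-link-edge {s} {v} s≢v sv≡pr with ∈-pair⁻ (subst (s ∈_) sv≡pr (∈-pairˡ s v))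
                                     | ∈-pair⁻ (subst (v ∈_) sv≡pr (∈-pairʳ s v))
  ... | inj₁ s≡p | inj₂ v≡r = inj₁ (s≡p , v≡r)
  ... | inj₂ s≡r | inj₁ v≡p = inj₂ (s≡r , v≡p)
  ... | inj₁ refl | inj₁ refl = contradiction refl s≢v
  ... | inj₂ refl | inj₂ refl = contradiction refl s≢v

  pair≢pqr : ∀ {s v} → ¬ s ≡ v → ¬ pair s v ≡ pqr
  pair≢pqr s≢v sv≡pqr with trans (sym (∣pair∣ s≢v)) (trans (cong ∣_∣ sv≡pqr) (∣triple∣ p≢q q≢r p≢r))
  ... | ()

  link-reach : ∀ v s → lk Γ v ⁅ s ⁆ → ∃ λ s′ → lk Δ v ⁅ s′ ⁆ × Reach (lk Γ v) s s′
  link-reach v s (v∉ , sv∈) with face Δ (pair s v) in sv∈Δ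
  ... | true  = s , (v∉ , sv∈Δ) , here
  ... | false with new-face (does⁻ (pair s v ⊆? pqr) sv∈) sv∈Δ
  ...   | inj₂ sv≡pqr = contradiction sv≡pqr (pair≢pqr (x∉⁅y⁆⇒x≢y v∉ ∘ sym))
  ...   | inj₁ sv≡pr with new-link-edge (x∉⁅y⁆⇒x≢y v∉ ∘ sym) sv≡pr
  ...     | inj₁ (refl , refl) = to-q p∈pqr r∈pqr (∉-pair (p≢r ∘ sym) (q≢r ∘ sym)) (q≢r ∘ sym) qr∈Δ
  ...     | inj₂ (refl , refl) = to-q r∈pqr p∈pqr (∉-pair p≢r p≢q) p≢q (subst (_∈Δ Δ) (pair-comm p q) pq∈Δ)

  old-link : ∀ {v} {G : Subset n} → lk Δ v G → lk Γ v G
  old-link (v∉G , G∈Δ) = v∉G , ∨-introˡ G∈Δ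

  fill-good : Good Δ → Good Γ
  fill-good (dim , conn , pure , links) =
    fill-twoDim dim , fill-connected conn , fill-pure pure ,
    λ v → connected-via id (walk-map old-link) (link-reach v) (links v)

missing-edge : ∀ {n} (Δ : Complex n) → faceCount Δ 2 < n C 2 → ∃₂ λ p r → ¬ p ≡ r × face Δ (pair p r) ≡ false
missing-edge {n} Δ few with count-∧-< (face Δ) (λ σ → ∣ σ ∣ ≡ᵇ 2) (subsets n)
                              (subst₂ _<_ (faceCount-count Δ 2) (sym (count-size n 2)) few)
... | σ , ∣σ∣≡ᵇ2 , σ∉Δ with size-2 σ (ℕP.≡ᵇ⇒≡ ∣ σ ∣ 2 (subst Bool.T (sym ∣σ∣≡ᵇ2) _))
...   | p , r , p≢r , refl = p , r , p≢r , σ∉Δ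

module _ {n : ℕ} (Δ : Complex n) (p : Fin n) where

  InducedPath : Set
  InducedPath = ∃₂ λ q r → ¬ p ≡ q × ¬ q ≡ r × ¬ p ≡ r
              × pair p q ∈Δ Δ × pair q r ∈Δ Δ × face Δ (pair p r) ≡ false

  Adjacent : Fin n → Set
  Adjacent u = ¬ p ≡ u × pair p u ∈Δ Δ

  induced-path : ∀ {u w} → Reach (faces Δ) u w → u ≡ p ⊎ Adjacent u
    → ¬ p ≡ w → face Δ (pair p w) ≡ false → InducedPath
  induced-path here (inj₁ refl)        p≢w _   = contradiction refl p≢w
  induced-path here (inj₂ (_ , pw∈Δ))  _   pw∉ = true≢false pw∈Δ pw∉
  induced-path {u} (step {v = v} uv∈Δ walk) start p≢w pw∉ with p ≟ v
  ... | yes refl = induced-path walk (inj₁ refl) p≢w pw∉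
  ... | no p≢v with face Δ (pair p v) in pv∈Δ
  ...   | true  = induced-path walk (inj₂ (p≢v , pv∈Δ)) p≢w pw∉
  ...   | false with start
  ...     | inj₁ refl         = true≢false uv∈Δ pv∈Δ
  ...     | inj₂ (p≢u , pu∈Δ) = u , v , p≢u , u≢v , p≢v , pu∈Δ , uv∈Δ , pv∈Δ
    where
    u≢v : ¬ u ≡ v
    u≢v refl = true≢false pu∈Δ pv∈Δ

vertices-from-h₁ : ∀ {n} (Δ : Complex n) {h} → h₁ Δ ≡ + h → n ≡ 3 + h
vertices-from-h₁ {n} Δ {h} e = ℤP.+-injective (begin
  + n                    ≡⟨ undo (+ n) ⟩
  (+ n ℤ.- + 3) ℤ.+ + 3  ≡⟨ cong (λ m → (+ m ℤ.- + 3) ℤ.+ + 3) (sym (vertexCount Δ)) ⟩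
  h₁ Δ ℤ.+ + 3           ≡⟨ cong (ℤ._+ + 3) e ⟩
  + (h + 3)              ≡⟨ cong +_ (+-comm h 3) ⟩
  + (3 + h)              ∎)
  where
  open ≡-Reasoning
  undo : ∀ m → m ≡ (m ℤ.- + 3) ℤ.+ + 3
  undo = solve-∀

edges-from-h₂ : ∀ {n} (Δ : Complex n) {v} → h₂ Δ ≡ + v → faceCount Δ 2 + 3 ≡ v + 2 * n
edges-from-h₂ {n} Δ {v} e = ℤP.+-injective (begin
  + edges ℤ.+ + 3                                     ≡⟨ undo (+ edges) (+ n) ⟩
  (+ edges ℤ.- + 2 ℤ.* + n ℤ.+ + 3) ℤ.+ + 2 ℤ.* + n  ≡⟨ cong (λ m → (+ edges ℤ.- + 2 ℤ.* + m ℤ.+ + 3) ℤ.+ + 2 ℤ.* + n) (sym (vertexCount Δ)) ⟩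
  h₂ Δ ℤ.+ + 2 ℤ.* + n                            ≡⟨ cong₂ ℤ._+_ e (sym (ℤP.pos-* 2 n)) ⟩
  + (v + 2 * n)                                   ∎)
  where
  open ≡-Reasoning
  edges : ℕ
  edges = faceCount Δ 2
  undo : ∀ x m → x ℤ.+ + 3 ≡ (x ℤ.- + 2 ℤ.* m ℤ.+ + 3) ℤ.+ + 2 ℤ.* m
  undo = solve-∀

choose-2-shift : ∀ h → (3 + h) C 2 + 3 ≡ suc h C 2 + 2 * (3 + h)
choose-2-shift h = begin
  (3 + h) C 2 + 3                                     ≡⟨ cong (_+ 3) (sym (nCk+nC[k+1]≡[n+1]C[k+1] (2 + h) 1)) ⟩
  ((2 + h) C 1 + (2 + h) C 2) + 3                     ≡⟨ cong (λ m → (m + (2 + h) C 2) + 3) (nC1≡n (2 + h)) ⟩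
  ((2 + h) + (2 + h) C 2) + 3                         ≡⟨ cong (λ m → ((2 + h) + m) + 3) (sym (nCk+nC[k+1]≡[n+1]C[k+1] (1 + h) 1)) ⟩
  ((2 + h) + ((1 + h) C 1 + (1 + h) C 2)) + 3         ≡⟨ cong (λ m → ((2 + h) + (m + (1 + h) C 2)) + 3) (nC1≡n (1 + h)) ⟩
  ((2 + h) + ((1 + h) + (1 + h) C 2)) + 3             ≡⟨ rearrange h (suc h C 2) ⟩
  suc h C 2 + 2 * (3 + h)                             ∎
  where
  open ≡-Reasoning
  rearrange : ∀ h t → ((2 + h) + ((1 + h) + t)) + 3 ≡ t + 2 * (3 + h)
  rearrange = ℕ-solve-∀

few-edges : ∀ {n} (Δ : Complex n) {h v} → h₁ Δ ≡ + h → h₂ Δ ≡ + v → v < suc h C 2 → faceCount Δ 2 < n C 2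
few-edges {n} Δ {h} {v} e₁ e₂ v<C = ℕP.+-cancelʳ-< 3 (faceCount Δ 2) (n C 2) (begin-strict
  faceCount Δ 2 + 3         ≡⟨ edges-from-h₂ Δ e₂ ⟩
  v + 2 * n                 ≡⟨ cong (λ m → v + 2 * m) n≡ ⟩
  v + 2 * (3 + h)           <⟨ ℕP.+-monoˡ-< (2 * (3 + h)) v<C ⟩
  suc h C 2 + 2 * (3 + h)   ≡⟨ choose-2-shift h ⟨
  (3 + h) C 2 + 3           ≡⟨ cong (λ m → m C 2 + 3) n≡ ⟨
  n C 2 + 3                 ∎)
  where
  open ℕP.≤-Reasoning
  n≡ : n ≡ 3 + h
  n≡ = vertices-from-h₁ Δ e₁

witness : ∀ {n} (Δ : Complex n) {a b c : ℤ} → Good Δ → h₁ Δ ≡ a → h₂ Δ ≡ b → h₃ Δ ≡ c → HasConnBuchsbaum a b c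
witness Δ (dim , conn , bb) e₁ e₂ e₃ = _ , Δ , dim , conn , bb , e₁ , e₂ , e₃

an-element : ∀ {n} (τ : Subset n) → 1 ≤ ∣ τ ∣ → ∃ λ i → i ∈ τ
an-element (true ∷ τ)  _      = zero , here
an-element (false ∷ τ) 1≤∣τ∣ with an-element τ 1≤∣τ∣
... | i , i∈τ = suc i , there i∈τ

two-elements : ∀ {n} (τ : Subset n) → 2 ≤ ∣ τ ∣ → ∃₂ λ a c → ¬ a ≡ c × a ∈ τ × c ∈ τ
two-elements (true ∷ τ)  (s≤s 1≤∣τ∣) with an-element τ 1≤∣τ∣
... | i , i∈τ = zero , suc i , (λ ()) , here , there i∈τ
two-elements (false ∷ τ) 2≤∣τ∣ with two-elements τ 2≤∣τ∣
... | a , c , a≢c , a∈τ , c∈τ = suc a , suc c , a≢c ∘ FinP.suc-injective , there a∈τ , there c∈τ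

-- A 2-dimensional complex has an edge (inside its triangle).
an-edge : ∀ {n} (Δ : Complex n) → TwoDim Δ → ∃₂ λ a c → ¬ a ≡ c × pair a c ∈Δ Δ
an-edge Δ ((τ , τ∈Δ , ∣τ∣≡3) , _) with two-elements τ (subst (2 ≤_) (sym ∣τ∣≡3) (s≤s (s≤s z≤n)))
... | a , c , a≢c , a∈τ , c∈τ = a , c , a≢c , downClosed Δ (pair a c) τ (pair⊆ a∈τ c∈τ) τ∈Δ

ear-at : ∀ {n} (Δ : Complex n) {a c : Fin n} {h : ℕ} {b d : ℤ} → ¬ a ≡ c → pair a c ∈Δ Δ
  → Good Δ → h₁ Δ ≡ + h → h₂ Δ ≡ b → h₃ Δ ≡ d → HasConnBuchsbaum (+ suc h) b d
ear-at Δ a≢c ac∈Δ good e₁ e₂ e₃ =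
  witness Γ (ear-good good) (trans (proj₁ h-ear) (cong (ℤ._+_ (+ 1)) e₁))
                            (trans (proj₁ (proj₂ h-ear)) e₂) (trans (proj₂ (proj₂ h-ear)) e₃)
  where open Ear Δ a≢c ac∈Δ

fill-at : ∀ {n} (Δ : Complex n) {p : Fin n} {h v : ℕ} {d : ℤ} → InducedPath Δ p
  → Good Δ → h₁ Δ ≡ + h → h₂ Δ ≡ + v → h₃ Δ ≡ d → HasConnBuchsbaum (+ h) (+ suc v) d
fill-at Δ (q , r , p≢q , q≢r , p≢r , pq∈Δ , qr∈Δ , pr∉Δ) good e₁ e₂ e₃ =
  witness Γ (fill-good good) (trans (proj₁ h-fill) e₁)
                             (trans (proj₁ (proj₂ h-fill)) (cong (ℤ._+_ (+ 1)) e₂)) (trans (proj₂ (proj₂ h-fill)) e₃)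
  where open Fill Δ p≢q q≢r p≢r pq∈Δ qr∈Δ pr∉Δ

ear-step : ∀ {a} {b c : ℤ} → HasConnBuchsbaum (+ a) b c → HasConnBuchsbaum (+ suc a) b c
ear-step (n , Δ , dim , conn , bb , e₁ , e₂ , e₃) with an-edge Δ dim
... | a , c , a≢c , ac∈Δ = ear-at Δ a≢c ac∈Δ (dim , conn , bb) e₁ e₂ e₃

-- While h₂ < C(h₁+1, 2), a missing edge {p,r} exists; filling along the induced path
-- found on a walk from p to r raises h₂ by one.
fill-step : ∀ {h v} {c : ℤ} → v < suc h C 2 → HasConnBuchsbaum (+ h) (+ v) c → HasConnBuchsbaum (+ h) (+ suc v) c
fill-step {h} {v} {c} v<C (n , Δ , dim , conn , bb , e₁ , e₂ , e₃) = fill (missing-edge Δ (few-edges Δ e₁ e₂ v<C))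
  where
  fill : (∃₂ λ p r → ¬ p ≡ r × face Δ (pair p r) ≡ false) → HasConnBuchsbaum (+ h) (+ suc v) c
  fill (p , r , p≢r , pr∉Δ) =
    fill-at Δ (induced-path Δ p (conn p r (singletons Δ p) (singletons Δ r)) (inj₁ refl) p≢r pr∉Δ)
            (dim , conn , bb) e₁ e₂ e₃

attach-ears : ∀ k {a} {b c : ℤ} → HasConnBuchsbaum (+ a) b c → HasConnBuchsbaum (+ (k + a)) b c
attach-ears zero    H = H
attach-ears (suc k) H = ear-step (attach-ears k H)

fill-up : ∀ d {h v} {c : ℤ} → d + v ≤ suc h C 2 → HasConnBuchsbaum (+ h) (+ v) c → HasConnBuchsbaum (+ h) (+ (d + v)) c
fill-up zero    _      H = H
fill-up (suc d) d+v<C H = fill-step d+v<C (fill-up d (ℕP.<⇒≤ d+v<C) H)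

lemma3p1 : (h1 h2 w x : ℕ) → 0 < w → 3 * w ≤ h2 → h2 ≤ suc h1 C 2
    → IsLeastX w x
    → HasConnBuchsbaum (+ x) (+ (h2 ⊓ (suc x C 2))) (- (+ w))
    → HasConnBuchsbaum (+ h1) (+ h2) (- (+ w))
lemma3p1 h1 h2 w x _ 3w≤h2 h2≤C (_ , minimal) H =
  subst (λ m → HasConnBuchsbaum (+ h1) (+ m) (- (+ w))) [h2-y]+y≡h2 (fill-up (h2 ∸ y) room widened)
  where
  y : ℕ
  y = h2 ⊓ (suc x C 2)
  [h2-y]+y≡h2 : (h2 ∸ y) + y ≡ h2
  [h2-y]+y≡h2 = ℕP.m∸n+n≡m (ℕP.m⊓n≤m h2 (suc x C 2))
  room : (h2 ∸ y) + y ≤ suc h1 C 2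
  room = subst (_≤ suc h1 C 2) (sym [h2-y]+y≡h2) h2≤C
  x≤h1 : x ≤ h1
  x≤h1 = ℕP.≮⇒≥ (λ h1<x → minimal h1 h1<x (ℕP.≤-trans 3w≤h2 h2≤C))
  widened : HasConnBuchsbaum (+ h1) (+ y) (- (+ w))
  widened = subst (λ m → HasConnBuchsbaum (+ m) (+ y) (- (+ w))) (ℕP.m∸n+n≡m x≤h1) (attach-ears (h1 ∸ x) H)
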